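{- Let $n\ge2$, let $E=(S_1,\dots,S_T)$ be any sequence of non-empty hyperedges $S_t\subseteq[n]$, and consider any execution of the algorithm RAND described in the context on $E$. Then for every step $t\in\{0,\dots,T\}$, every node $i\in[n]$ and every integer $\ell\ge0$, \[ s^t_{i,\ell}\;\le\;\sum_{j\in[n]}\ \sum_{r=0}^{\ell-h} w^t_{j,r}, \] where the inner sum is empty (equal to $0$) if $\ell<h$.
   Context: Nodes are $[n]$, and $h=\lceil\log_2 n\rceil$. For integers $k\ge0$, let $R_k=\{2^k,\dots,2^{k+1}-1\}$ and $q_k=\lceil(1-\tfrac{1}{2n})2^k\rceil$. Algorithm RAND. For each node $i$ it maintains a phase $p(i)$, initially $0$, and for each $k\ge0$ a set $C_{i,k}$, initially empty. When hyperedge $S$ arrives in step $t$, RAND does the following. - Let $p_S=\min_{i\in S}p(i)$, using the current phases. - Sample $k^*$ uniformly from $\{p_S,\dots,p_S+h-1\}$. - Sample a color $r$ uniformly from $R_{k^*}$, and color $S$ with $r$. - For each $i\in S$: set $C_{i,k^*}\leftarrow C_{i,k^*}\cup\{r\}$; then, if $|C_{i,p(i)}|\ge q_{p(i)}$, set $p(i)\leftarrow p(i)+1$. Counters for the analysis. For all $i\in[n]$ and $k\ge0$, the counters $w_{i,k}$ and $s_{i,k}$ are initially $0$. In the step in which $S$ arrives, for each node $i\in S$ let $p(i)$ denote its phase before the step. If $p(i)\le p_S+h-1$, increment $w_{i,p(i)}$ by one; otherwise, i.e. if $p(i)\ge p_S+h$, increment $s_{i,p(i)}$ by one. The superscript $t$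 denotes the value at the end of step $t$; $t=0$ denotes the initial values. -}

module Defs where

open import Data.Nat using (ℕ; zero; suc; _+_; _*_; _∸_; _^_; _≤_; _<_; _⊓_; _≡ᵇ_; _<ᵇ_)
open import Data.Nat.DivMod using (_/_)
open import Data.Nat.Logarithm using (⌈log₂_⌉)
open import Data.Bool using (Bool; true; false; if_then_else_; _∧_)
open import Data.List using (List; []; _∷_; foldr; map; filterᵇ; allFin; length; upTo)
open import Data.Bool.ListAction using (any)
open import Data.Nat.ListAction using (sum)
open import Data.Fin using (Fin)
open import Data.Fin.Subset using (Subset; Nonempty)
open import Data.Vec using (lookup)

hh : ℕ → ℕ
hh n = ⌈log₂ n ⌉

ceilDivSuc : ℕ → ℕ → ℕ
ceilDivSuc a b = (a + b) / suc b

-- q_k = ⌈(1 - 1/(2n)) 2^k⌉ = ⌈(2n-1) 2^k / (2n)⌉ ; for n ≥ 1, 2n = suc (2n ∸ 1)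
qq : ℕ → ℕ → ℕ
qq n k = ceilDivSuc ((2 * n ∸ 1) * 2 ^ k) (2 * n ∸ 1)

-- minimum of a list of naturals (0 for the empty list; never used on empty lists)
minL : List ℕ → ℕ
minL [] = 0
minL (x ∷ xs) = foldr _⊓_ x xs

members : ∀ {n} → Subset n → List (Fin n)
members {n} S = filterᵇ (lookup S) (allFin n)

-- finite sets of colours as duplicate-free lists
insertSet : ℕ → List ℕ → List ℕ
insertSet r xs = if any (r ≡ᵇ_) xs then xs else r ∷ xs

-- state of RAND together with the analysis counters
record State (n : ℕ) : Set where
  field
    phase : Fin n → ℕ
    C     : Fin n → ℕ → List ℕ
    w     : Fin n → ℕ → ℕ
    s     : Fin n → ℕ → ℕ
open State public

initState : ∀ n → State n
initState n = record { phase = λ _ → 0 ; C = λ _ _ → [] ; w = λ _ _ → 0 ; s = λ _ _ → 0 }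

pS : ∀ {n} → State n → Subset n → ℕ
pS st S = minL (map (phase st) (members S))

step : ∀ n → State n → Subset n → ℕ → ℕ → State n
step n st S ks r = record { phase = ph' ; C = C' ; w = w' ; s = s' }
  where
  p₀ : ℕ
  p₀ = pS st S
  C' : Fin n → ℕ → List ℕ
  C' i k = if lookup S i ∧ (k ≡ᵇ ks) then insertSet r (C st i k) else C st i k
  ph' : Fin n → ℕ
  ph' i = if lookup S i ∧ (qq n (phase st i) ≤ᵇ' length (C' i (phase st i)))
            then suc (phase st i) else phase st i
    where
    _≤ᵇ'_ : ℕ → ℕ → Bool
    a ≤ᵇ' b = a <ᵇ suc b
  -- "p(i) ≤ p_S + h - 1" is written p(i) < p_S + h (h ≥ 1 since n ≥ 2)
  w' : Fin n → ℕ → ℕ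
  w' i k = if lookup S i ∧ (k ≡ᵇ phase st i) ∧ (phase st i <ᵇ p₀ + hh n)
             then suc (w st i k) else w st i k
  s' : Fin n → ℕ → ℕ
  s' i k = if lookup S i ∧ (k ≡ᵇ phase st i) ∧ (p₀ + hh n <ᵇ suc (phase st i))
             then suc (s st i k) else s st i k

-- the state at the end of step t (t = 0: initial state), for hyperedges E and
-- sampled values ks (the k*) and rs (the colours)
run : ∀ n → (ℕ → Subset n) → (ℕ → ℕ) → (ℕ → ℕ) → ℕ → State n
run n E ks rs zero = initState n
run n E ks rs (suc t) = step n (run n E ks rs t) (E t) (ks t) (rs t)

-- the samples of step t+1 (0-based t) are in the support of RAND's distributions
ValidExecution : ∀ n → ℕ → (ℕ → Subset n) → (ℕ → ℕ) → (ℕ → ℕ) → Set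
ValidExecution n T E ks rs = ∀ t → t < T →
  pS (run n E ks rs t) (E t) ≤ ks t × ks t < pS (run n E ks rs t) (E t) + hh n
  × 2 ^ ks t ≤ rs t × rs t < 2 ^ suc (ks t)
  where open import Data.Product using (_×_)

wSum : ∀ n → State n → ℕ → ℕ
wSum n st ℓ = sum (map (λ j → sum (map (w st j) (upTo (suc ℓ ∸ hh n)))) (allFin n))

{-# OPTIONS --safe #-}
-- A step increments s_{i,ℓ} only when i ∈ S and ℓ = p(i) ≥ p_S + h. In that same step a node
-- j ∈ S with p(j) = p_S satisfies p(j) ≤ p_S + h - 1 (as h ≥ 1), so w_{j,p_S} increments, and
-- p_S ≤ ℓ - h places it in the right-hand sum. Otherwise both sides can only grow, so the
-- inequality is an invariant of every step, whatever k* and colour are sampled.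
module Submission where

open import Defs
open import Data.Nat using (ℕ; _≤_; _<_; zero; suc; _+_; _∸_; _≡ᵇ_; _<ᵇ_; s≤s; z≤n; s≤s⁻¹)
open import Data.Nat.Properties
  using (≤-refl; ≤-reflexive; n≤1+n; m<m+n; +-mono-≤; +-mono-<-≤; +-mono-≤-<;
         m+n≤o⇒m≤o∸n; ≡ᵇ⇒≡; ≡⇒≡ᵇ; <ᵇ⇒<; <⇒<ᵇ; ⊓-sel; module ≤-Reasoning)
open import Data.Nat.ListAction using (sum)
open import Data.Nat.Logarithm using (⌈log₂⌉-mono-≤)
open import Data.Fin using (Fin)
open import Data.Fin.Subset using (Subset; Nonempty)
open import Data.Bool using (true; false; T; _∧_)
open import Data.Bool.Properties using (T?; T-≡)
open import Data.List using ([]; _∷_; map; allFin; upTo)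
open import Data.List.Relation.Unary.Any using (here; there)
open import Data.List.Membership.Propositional using (_∈_)
open import Data.List.Membership.Propositional.Properties
  using (foldr-selective; ∈-map⁺; ∈-map⁻; ∈-filter⁺; ∈-filter⁻; ∈-upTo⁺; ∈-allFin)
open import Data.Vec using (lookup)
open import Data.Product using (_×_; _,_; ∃-syntax; proj₂)
open import Data.Sum using (_⊎_; inj₁; inj₂; [_,_]′)
open import Function.Bundles using (Equivalence)
open import Relation.Binary.PropositionalEquality using (_≡_; refl; sym)

minL-∈ : ∀ {x : ℕ} {xs} → x ∈ xs → minL xs ∈ xs
minL-∈ {xs = y ∷ ys} _ = [ here , there ]′ (foldr-selective ⊓-sel y ys)

sum-map-mono-≤ : ∀ {A : Set} {f g : A → ℕ} → (∀ x → f x ≤ g x) →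
                 ∀ xs → sum (map f xs) ≤ sum (map g xs)
sum-map-mono-≤ f≤g []       = ≤-refl
sum-map-mono-≤ f≤g (x ∷ xs) = +-mono-≤ (f≤g x) (sum-map-mono-≤ f≤g xs)

sum-map-mono-< : ∀ {A : Set} {f g : A → ℕ} → (∀ x → f x ≤ g x) →
                 ∀ {y} xs → y ∈ xs → f y < g y → sum (map f xs) < sum (map g xs)
sum-map-mono-< f≤g (x ∷ xs) (here refl) fy<gy = +-mono-<-≤ fy<gy (sum-map-mono-≤ f≤g xs)
sum-map-mono-< f≤g (x ∷ xs) (there y∈xs) fy<gy =
  +-mono-≤-< (f≤g x) (sum-map-mono-< f≤g xs y∈xs fy<gy)

module _ {n : ℕ} (S : Subset n) where

  ∈-members⁺ : ∀ {i} → T (lookup S i) → i ∈ members S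
  ∈-members⁺ {i} = ∈-filter⁺ (λ j → T? (lookup S j)) (∈-allFin i)

  ∈-members⁻ : ∀ {i} → i ∈ members S → T (lookup S i)
  ∈-members⁻ i∈S = proj₂ (∈-filter⁻ (λ j → T? (lookup S j)) {xs = allFin n} i∈S)

  pS-attained : (st : State n) → ∀ {i} → T (lookup S i) →
                ∃[ j ] T (lookup S j) × phase st j ≡ pS st S
  pS-attained st i∈S with ∈-map⁻ (phase st) (minL-∈ (∈-map⁺ (phase st) (∈-members⁺ i∈S)))
  ... | j , j∈S , pS≡ = j , ∈-members⁻ j∈S , sym pS≡

module _ {n : ℕ} {st st′ : State n} (w≤w′ : ∀ j k → w st j k ≤ w st′ j k) where

  private
    rows-mono-≤ : ∀ ℓ j → sum (map (w st j) (upTo (suc ℓ ∸ hh n)))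
                        ≤ sum (map (w st′ j) (upTo (suc ℓ ∸ hh n)))
    rows-mono-≤ ℓ j = sum-map-mono-≤ (w≤w′ j) (upTo (suc ℓ ∸ hh n))

  wSum-mono-≤ : ∀ ℓ → wSum n st ℓ ≤ wSum n st′ ℓ
  wSum-mono-≤ ℓ = sum-map-mono-≤ (rows-mono-≤ ℓ) (allFin n)

  wSum-mono-< : ∀ ℓ j r → r + hh n ≤ ℓ → w st j r < w st′ j r → wSum n st ℓ < wSum n st′ ℓ
  wSum-mono-< ℓ j r r+h≤ℓ w<w′ =
    sum-map-mono-< (rows-mono-≤ ℓ) (allFin n) (∈-allFin j)
      (sum-map-mono-< (w≤w′ j) (upTo (suc ℓ ∸ hh n)) r∈upTo w<w′)
    where
    r∈upTo : r ∈ upTo (suc ℓ ∸ hh n)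
    r∈upTo = ∈-upTo⁺ (m+n≤o⇒m≤o∸n (suc r) (s≤s r+h≤ℓ))

SBoundedByWSum : ∀ n → State n → Set
SBoundedByWSum n st = ∀ i ℓ → s st i ℓ ≤ wSum n st ℓ

module _ {n : ℕ} (st : State n) (S : Subset n) (ks r : ℕ) where

  private
    st′ : State n
    st′ = step n st S ks r

    T⇒≡true : ∀ {b} → T b → b ≡ true
    T⇒≡true = Equivalence.to T-≡

    ≡true⇒T : ∀ {b} → b ≡ true → T b
    ≡true⇒T = Equivalence.from T-≡

  w-step-mono : ∀ j k → w st j k ≤ w st′ j k
  w-step-mono j k with lookup S j ∧ (k ≡ᵇ phase st j) ∧ (phase st j <ᵇ pS st S + hh n)
  ... | true  = n≤1+n _
  ... | false = ≤-refl

  w-step-minimal : ∀ {j} → 0 < hh n → T (lookup S j) → phase st j ≡ pS st S →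
                   w st′ j (pS st S) ≡ suc (w st j (pS st S))
  w-step-minimal {j} h>0 j∈S pj≡pS
    rewrite T⇒≡true j∈S
          | T⇒≡true (≡⇒≡ᵇ (pS st S) (phase st j) (sym pj≡pS))
          | pj≡pS
          | T⇒≡true (<⇒<ᵇ (m<m+n (pS st S) h>0)) = refl

  s-step : ∀ i ℓ → s st′ i ℓ ≡ s st i ℓ
                 ⊎ (s st′ i ℓ ≡ suc (s st i ℓ) × T (lookup S i) × pS st S + hh n ≤ ℓ)
  s-step i ℓ with lookup S i | ℓ ≡ᵇ phase st i in ℓ≡p
                | pS st S + hh n <ᵇ suc (phase st i) in pS+h<1+p
  ... | true  | true  | true  = inj₂ (refl , _ , s≤s⁻¹ pS+h<1+ℓ)
    where
    pS+h<1+ℓ : pS st S + hh n < suc ℓ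
    pS+h<1+ℓ rewrite ≡ᵇ⇒≡ ℓ (phase st i) (≡true⇒T ℓ≡p) = <ᵇ⇒< _ _ (≡true⇒T pS+h<1+p)
  ... | true  | true  | false = inj₁ refl
  ... | true  | false | _     = inj₁ refl
  ... | false | _     | _     = inj₁ refl

  step-preserves-SBoundedByWSum : 0 < hh n → SBoundedByWSum n st → SBoundedByWSum n st′
  step-preserves-SBoundedByWSum h>0 s≤wSum i ℓ with s-step i ℓ
  ... | inj₁ s′≡s = begin
    s st′ i ℓ     ≡⟨ s′≡s ⟩
    s st i ℓ      ≤⟨ s≤wSum i ℓ ⟩
    wSum n st ℓ   ≤⟨ wSum-mono-≤ {st = st} {st′} w-step-mono ℓ ⟩
    wSum n st′ ℓ  ∎
    where open ≤-Reasoning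
  ... | inj₂ (s′≡1+s , i∈S , pS+h≤ℓ) with pS-attained S st i∈S
  ... | j , j∈S , pj≡pS = begin
    s st′ i ℓ          ≡⟨ s′≡1+s ⟩
    suc (s st i ℓ)     ≤⟨ s≤s (s≤wSum i ℓ) ⟩
    suc (wSum n st ℓ)  ≤⟨ wSum-mono-< {st = st} {st′} w-step-mono ℓ j (pS st S) pS+h≤ℓ
                            (≤-reflexive (sym (w-step-minimal h>0 j∈S pj≡pS))) ⟩
    wSum n st′ ℓ       ∎
    where open ≤-Reasoning

run-SBoundedByWSum : ∀ n → 0 < hh n → ∀ E ks rs t → SBoundedByWSum n (run n E ks rs t)
run-SBoundedByWSum n h>0 E ks rs zero          i ℓ = z≤n
run-SBoundedByWSum n h>0 E ks rs (suc t) =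
  step-preserves-SBoundedByWSum (run n E ks rs t) (E t) (ks t) (rs t) h>0
    (run-SBoundedByWSum n h>0 E ks rs t)

lemma9 : (n : ℕ) → 2 ≤ n → (T : ℕ) → (E : ℕ → Subset n) →
         (∀ t → t < T → Nonempty (E t)) →
         (ks rs : ℕ → ℕ) → ValidExecution n T E ks rs →
         ∀ t → t ≤ T → ∀ (i : Fin n) (ℓ : ℕ) →
         s (run n E ks rs t) i ℓ ≤ wSum n (run n E ks rs t) ℓ
lemma9 n 2≤n _ E _ ks rs _ t _ = run-SBoundedByWSum n (⌈log₂⌉-mono-≤ 2≤n) E ks rs t
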